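{- Let $G$ be a Meyniel graph, let $Q$ be a clique of $G$, let $X$ be a nonempty set of vertices of $G\setminus Q$ inducing a connected subgraph, and let $z$ be a vertex not in $Q\cup X$. Suppose that $z$ is adjacent to all vertices of $Q$ and to no vertex of $X$, and that each vertex of $X$ has a non-neighbour in $Q$. Then some vertex of $Q$ has no neighbour in $X$.
   Context: All graphs are finite and simple. A Meyniel graph is a graph in which every odd cycle has at least two chords; equivalently, a graph with no induced odd hole (chordless cycle of odd length at least $5$) and no induced house (a cycle of length at least five whose only chord joins two vertices at distance two on the cycle). -}

module Defs where

open import Data.Nat using (ℕ; zero; suc; _+_; _*_; _≤_; _<_)
open import Data.Nat.Properties using (_≟_)
open import Data.Fin using (Fin; toℕ)
open import Data.Fin.Subset using (Subset; _∈_; _∉_)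
open import Data.Product using (Σ; ∃; ∃-syntax; _×_; _,_)
open import Data.Sum using (_⊎_)
open import Data.Empty using (⊥)
open import Relation.Nullary using (¬_; Dec)
open import Relation.Binary.PropositionalEquality using (_≡_; _≢_)
open import Function.Definitions using (Injective)

record Graph (n : ℕ) : Set₁ where
  field
    Adj   : Fin n → Fin n → Set
    sym   : ∀ {u v} → Adj u v → Adj v u
    irrefl : ∀ {u} → ¬ Adj u u
    dec   : ∀ u v → Dec (Adj u v)
open Graph public

module _ {n : ℕ} (G : Graph n) where

  Consecutive : (k : ℕ) → Fin k → Fin k → Set
  Consecutive k i j = (suc (toℕ i) ≡ toℕ j) ⊎ (suc (toℕ j) ≡ toℕ i)
                      ⊎ ((suc (toℕ i) ≡ k) × (toℕ j ≡ 0))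
                      ⊎ ((suc (toℕ j) ≡ k) × (toℕ i ≡ 0))

  record Cycle (k : ℕ) : Set where
    field
      len≥3 : 3 ≤ k
      vert  : Fin k → Fin n
      inj   : Injective _≡_ _≡_ vert
      edges : ∀ i j → Consecutive k i j → Adj G (vert i) (vert j)
  open Cycle public

  -- a chord of a cycle: a pair of positions i < j, not consecutive on
  -- the cycle, whose vertices are adjacent (unordered pairs are
  -- represented by ordering the positions).
  Chord : {k : ℕ} → Cycle k → Fin k → Fin k → Set
  Chord {k} C i j = (toℕ i < toℕ j) × ¬ Consecutive k i j
                    × Adj G (vert C i) (vert C j)

  Odd : ℕ → Set
  Odd k = ∃[ m ] k ≡ suc (2 * m)

  -- Meyniel: every odd cycle of length at least 5 has at least two
  -- (distinct) chords.  (Triangles have no chords; the standard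
  -- definition concerns odd cycles of length ≥ 5.)
  Meyniel : Set
  Meyniel = ∀ (k : ℕ) (C : Cycle k) → 5 ≤ k → Odd k →
            ∃[ i ] ∃[ j ] ∃[ i' ] ∃[ j' ]
              (Chord C i j × Chord C i' j' × ¬ ((i ≡ i') × (j ≡ j')))

  IsClique : Subset n → Set
  IsClique Q = ∀ u v → u ∈ Q → v ∈ Q → u ≢ v → Adj G u v

  data WalkIn (X : Subset n) : Fin n → Fin n → Set where
    here : ∀ {u} → u ∈ X → WalkIn X u u
    step : ∀ {u w v} → u ∈ X → Adj G u w → WalkIn X w v → WalkIn X u v

  Connected : Subset n → Set
  Connected X = ∀ u v → u ∈ X → v ∈ X → WalkIn X u v

  Nonempty : Subset n → Set
  Nonempty X = ∃[ x ] x ∈ X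

-- If every vertex of Q had a neighbour in X, take x ∈ X whose set of neighbours in Q is maximal,
-- q ∈ Q not adjacent to x, and a shortest path in X from x to a vertex e adjacent to q.  Every
-- Q-neighbour q′ of x is adjacent to e: otherwise a shortest subpath u₀ … uₘ from a neighbour of q′
-- to a neighbour of q, together with the triangle z q′ q, yields the chordless cycle q q′ u₀ … uₘ
-- and the cycle q z q′ u₀ … uₘ whose only chord is q q′; one of them is odd and of length at
-- least five, which a Meyniel graph forbids.  So e has strictly more neighbours in Q than x.
module Submission where

open import Defs
open import Level using (0ℓ)
open import Function using (_∘_)
open import Data.Bool using (true)
open import Data.Empty using (⊥; ⊥-elim)
open import Data.Product using (Σ; ∃; ∃-syntax; _×_; _,_; proj₁; proj₂)
open import Data.Sum using (_⊎_; inj₁; inj₂)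
open import Data.Nat using (ℕ; zero; suc; _+_; _∸_; _≤_; _<_; z≤n; s≤s; z<s; _≤?_; _<?_)
open import Data.Nat.Properties
  using ( ≤-refl; ≤-trans; ≤-reflexive; ≤-pred; <⇒≤; <⇒≢; <⇒≱; <-trans; <-≤-trans; <-cmp; n<1+n
        ; m<n⇒m<1+n; m≤n⇒m<n∨m≡n; n≢0⇒n>0; +-suc; +-identityʳ; +-monoˡ-≤; +-monoʳ-≤
        ; m∸n≤m; m+[n∸m]≡n; m∸n+n≡m; m+n≤o⇒m≤o∸n; ∸-monoʳ-<; m<n⇒0<n∸m; anyUpTo? )
open import Data.Nat.Induction using (<-wellFounded)
open import Data.Fin using (Fin; toℕ; _≟_)
open import Data.Fin.Properties using (toℕ-injective; toℕ<n; any?)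
open import Data.Fin.Subset using (Subset; _∈_; _∉_; _⊆_; _⊂_; _⊃_)
open import Data.Fin.Subset.Properties using (_∈?_)
open import Data.Fin.Subset.Induction using (⊃-wellFounded)
open import Data.Vec using (tabulate)
open import Data.Vec.Properties using (lookup∘tabulate; lookup⇒[]=; []=⇒lookup)
open import Induction.WellFounded using (Acc; acc)
open import Relation.Binary.Definitions using (tri<; tri≈; tri>)
open import Relation.Binary.PropositionalEquality as ≡ using (_≡_; _≢_; refl; cong; subst; subst₂)
open import Relation.Nullary using (¬_; Dec; yes; no; contradiction)
open import Relation.Nullary.Decidable using (does; _×-dec_; ¬?; dec-true; decidable-stable)
open import Relation.Unary using (Pred; Decidable)

infixr 5 _◁_

_◁_ : {A : Set} → A → (ℕ → A) → ℕ → A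
(a ◁ f) zero    = a
(a ◁ f) (suc i) = f i

module _ {A : Set} {ℓ : ℕ} {x : A} {f : ℕ → A} where

  ◁-avoids : ∀ {y} → x ≢ y → (∀ {j} → j ≤ ℓ → f j ≢ y) → ∀ {j} → j ≤ suc ℓ → (x ◁ f) j ≢ y
  ◁-avoids x≢y _   {zero}  _           = x≢y
  ◁-avoids _   f≢y {suc j} (s≤s j≤ℓ) = f≢y j≤ℓ

  ◁-injective : (∀ {j} → j ≤ ℓ → f j ≢ x) →
                (∀ {i j} → i ≤ ℓ → j ≤ ℓ → f i ≡ f j → i ≡ j) →
                ∀ {i j} → i ≤ suc ℓ → j ≤ suc ℓ → (x ◁ f) i ≡ (x ◁ f) j → i ≡ j
  ◁-injective _   _     {zero}  {zero}  _          _          _  = refl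
  ◁-injective f≢x _     {zero}  {suc j} _          (s≤s j≤ℓ) eq = contradiction (≡.sym eq) (f≢x j≤ℓ)
  ◁-injective f≢x _     {suc i} {zero}  (s≤s i≤ℓ) _          eq = contradiction eq (f≢x i≤ℓ)
  ◁-injective _   f-inj {suc i} {suc j} (s≤s i≤ℓ) (s≤s j≤ℓ) eq = cong suc (f-inj i≤ℓ j≤ℓ eq)

skip : ℕ → ℕ → ℕ → ℕ
skip i d t with t ≤? i
... | yes _ = t
... | no  _ = t + d

skip-≤ : ∀ {i d t} → t ≤ i → skip i d t ≡ t
skip-≤ {i} {d} {t} t≤i with t ≤? i
... | yes _   = refl
... | no  t≰i = contradiction t≤i t≰i

skip-> : ∀ {i d t} → i < t → skip i d t ≡ t + d
skip-> {i} {d} {t} i<t with t ≤? i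
... | yes t≤i = contradiction t≤i (<⇒≱ i<t)
... | no  _   = refl

module _ {n : ℕ} {P : Pred (Fin n) 0ℓ} (P? : Decidable P) where

  toSubset : Subset n
  toSubset = tabulate (does ∘ P?)

  ∈-toSubset⁺ : ∀ {x} → P x → x ∈ toSubset
  ∈-toSubset⁺ {x} Px = lookup⇒[]= x toSubset (≡.trans (lookup∘tabulate (does ∘ P?) x) (dec-true (P? x) Px))

  ∈-toSubset⁻ : ∀ {x} → x ∈ toSubset → P x
  ∈-toSubset⁻ {x} x∈ = witness (P? x) (≡.trans (≡.sym (lookup∘tabulate (does ∘ P?) x)) ([]=⇒lookup x∈))
    where
    witness : (Px? : Dec (P x)) → does Px? ≡ true → P x
    witness (yes Px) _ = Px

module _ {n : ℕ} (G : Graph n) where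

  adj⇒≢ : ∀ {u v} → Adj G u v → u ≢ v
  adj⇒≢ u~v refl = irrefl G u~v

  ◁-edge : ∀ {ℓ x f} → Adj G x (f 0) → (∀ {i} → i < ℓ → Adj G (f i) (f (suc i))) →
           ∀ {i} → i < suc ℓ → Adj G ((x ◁ f) i) ((x ◁ f) (suc i))
  ◁-edge x~f _      {zero}  _          = x~f
  ◁-edge _   f-edge {suc i} (s≤s i<ℓ) = f-edge i<ℓ

  record CyclicSequence (ℓ : ℕ) : Set where
    field
      vertex    : ℕ → Fin n
      2≤ℓ       : 2 ≤ ℓ
      injective : ∀ {i j} → i ≤ ℓ → j ≤ ℓ → vertex i ≡ vertex j → i ≡ j
      edge      : ∀ {i} → i < ℓ → Adj G (vertex i) (vertex (suc i))
      close     : Adj G (vertex ℓ) (vertex 0)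

    toCycle : Cycle G (suc ℓ)
    toCycle = record
      { len≥3 = s≤s 2≤ℓ
      ; vert  = vertex ∘ toℕ
      ; inj   = λ eq → toℕ-injective (injective (bounded _) (bounded _) eq)
      ; edges = consecutive⇒adj
      }
      where
      bounded : (i : Fin (suc ℓ)) → toℕ i ≤ ℓ
      bounded i = ≤-pred (toℕ<n i)
      edge′ : ∀ {i j} → suc i ≡ j → j ≤ ℓ → Adj G (vertex i) (vertex j)
      edge′ refl = edge
      close′ : ∀ {i j} → suc i ≡ suc ℓ → j ≡ 0 → Adj G (vertex i) (vertex j)
      close′ refl refl = close
      consecutive⇒adj : ∀ i j → Consecutive G (suc ℓ) i j → Adj G (vertex (toℕ i)) (vertex (toℕ j))
      consecutive⇒adj i j (inj₁ e)                  = edge′ e (bounded j)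
      consecutive⇒adj i j (inj₂ (inj₁ e))           = sym G (edge′ e (bounded i))
      consecutive⇒adj i j (inj₂ (inj₂ (inj₁ (e , e′)))) = close′ e e′
      consecutive⇒adj i j (inj₂ (inj₂ (inj₂ (e , e′)))) = sym G (close′ e e′)

    ChordsWithin : (ℕ → ℕ → Set) → Set
    ChordsWithin E = ∀ {i j} → i < j → j ≤ ℓ → Adj G (vertex i) (vertex j) →
                     suc i ≡ j ⊎ (i ≡ 0 × j ≡ ℓ) ⊎ E i j

    chordsWithin : ∀ {E i j} → ChordsWithin E → Chord G toCycle i j → E (toℕ i) (toℕ j)
    chordsWithin {j = j} within (i<j , ¬consecutive , i~j) with within i<j (≤-pred (toℕ<n j)) i~j
    ... | inj₁ e                = contradiction (inj₁ e) ¬consecutive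
    ... | inj₂ (inj₁ (e , e′)) = contradiction (inj₂ (inj₂ (inj₂ (cong suc e′ , e)))) ¬consecutive
    ... | inj₂ (inj₂ extra)    = extra

  odd⊎odd-suc : ∀ k → Odd G k ⊎ Odd G (suc k)
  odd⊎odd-suc zero = inj₂ (0 , refl)
  odd⊎odd-suc (suc k) with odd⊎odd-suc k
  ... | inj₁ (m , refl) = inj₂ (suc m , cong (suc ∘ suc) (≡.sym (+-suc m (m + 0))))
  ... | inj₂ odd        = inj₁ odd

  ¬odd4 : ¬ Odd G 4
  ¬odd4 (suc (suc (suc zero))     , ())
  ¬odd4 (suc (suc (suc (suc _))) , ())

  odd-3+k⇒2≤k : ∀ {k} → 0 < k → Odd G (3 + k) → 2 ≤ k
  odd-3+k⇒2≤k {suc zero}    _ odd = contradiction odd ¬odd4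
  odd-3+k⇒2≤k {suc (suc _)} _ _   = s≤s (s≤s z≤n)

  AtMostOnePair : (ℕ → ℕ → Set) → Set
  AtMostOnePair E = ∀ {i j i′ j′} → E i j → E i′ j′ → i ≡ i′ × j ≡ j′

  Meyniel⇒¬oddCycleWithAtMostOneChord : Meyniel G → ∀ {ℓ} (C : CyclicSequence ℓ) → 4 ≤ ℓ → Odd G (suc ℓ) →
    ∀ {E} → AtMostOnePair E → CyclicSequence.ChordsWithin C E → ⊥
  Meyniel⇒¬oddCycleWithAtMostOneChord meyniel {ℓ} C 4≤ℓ odd one within =
    let _ , _ , _ , _ , chord , chord′ , distinct = meyniel (suc ℓ) toCycle (s≤s 4≤ℓ) odd
        i≡i′ , j≡j′ = one (chordsWithin within chord) (chordsWithin within chord′)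
    in  distinct (toℕ-injective i≡i′ , toℕ-injective j≡j′)
    where open CyclicSequence C

  record Walk (I S T : Pred (Fin n) 0ℓ) : Set where
    field
      len    : ℕ
      vertex : ℕ → Fin n
      inside : ∀ {i} → i ≤ len → I (vertex i)
      edge   : ∀ {i} → i < len → Adj G (vertex i) (vertex (suc i))
      start  : S (vertex 0)
      end    : T (vertex len)

    last : Fin n
    last = vertex len

  open Walk

  -- Every shortest walk from S to T is tight.
  record Tight {I S T : Pred (Fin n) 0ℓ} (W : Walk I S T) : Set where
    field
      T-only-at-end   : ∀ {i} → i < len W → ¬ T (vertex W i)
      S-only-at-start : ∀ {i} → 0 < i → i ≤ len W → ¬ S (vertex W i)
      chordless       : ∀ {i j} → suc i < j → j ≤ len W → ¬ Adj G (vertex W i) (vertex W j)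

  module _ {I S T : Pred (Fin n) 0ℓ} where

    prepend : ∀ {a} → I a → (W : Walk I S T) → Adj G a (vertex W 0) → Walk I (_≡ a) T
    prepend {a} Ia W a~W = record
      { len    = suc (len W)
      ; vertex = a ◁ vertex W
      ; inside = λ { {zero} _ → Ia ; {suc i} (s≤s i≤len) → inside W i≤len }
      ; edge   = ◁-edge a~W (edge W)
      ; start  = refl
      ; end    = end W
      }

    truncate : (W : Walk I S T) {k : ℕ} → k ≤ len W → T (vertex W k) → Walk I S T
    truncate W k≤len Tk = record
      { len    = _
      ; vertex = vertex W
      ; inside = λ i≤k → inside W (≤-trans i≤k k≤len)
      ; edge   = λ i<k → edge W (<-≤-trans i<k k≤len)
      ; start  = start W
      ; end    = Tk
      }

    dropPrefix : (W : Walk I S T) {k : ℕ} → k ≤ len W → S (vertex W k) → Walk I S T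
    dropPrefix W {k} k≤len Sk = record
      { len    = len W ∸ k
      ; vertex = λ t → vertex W (k + t)
      ; inside = λ t≤ → inside W (shifted t≤)
      ; edge   = λ {t} t< → subst (Adj G (vertex W (k + t)) ∘ vertex W) (≡.sym (+-suc k t))
                                  (edge W (subst (_≤ len W) (+-suc k t) (shifted t<)))
      ; start  = subst (S ∘ vertex W) (≡.sym (+-identityʳ k)) Sk
      ; end    = subst (T ∘ vertex W) (≡.sym (m+[n∸m]≡n k≤len)) (end W)
      }
      where
      shifted : ∀ {t} → t ≤ len W ∸ k → k + t ≤ len W
      shifted t≤ = ≤-trans (+-monoʳ-≤ k t≤) (≤-reflexive (m+[n∸m]≡n k≤len))

    shortcut : (W : Walk I S T) {i j : ℕ} → suc i < j → j ≤ len W →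
               Adj G (vertex W i) (vertex W j) → Walk I S T
    shortcut W {i} {j} 1+i<j j≤len i~j = record
      { len    = len W ∸ d
      ; vertex = vertex W ∘ skip i d
      ; inside = inside′
      ; edge   = edge′
      ; start  = subst (S ∘ vertex W) (≡.sym (skip-≤ {i} {d} z≤n)) (start W)
      ; end    = subst (T ∘ vertex W) (≡.sym (≡.trans (skip-> i<len′) (m∸n+n≡m d≤len))) (end W)
      }
      where
      d : ℕ
      d = j ∸ suc i
      1+i+d≡j : suc i + d ≡ j
      1+i+d≡j = m+[n∸m]≡n (<⇒≤ 1+i<j)
      d≤len : d ≤ len W
      d≤len = ≤-trans (m∸n≤m j (suc i)) j≤len
      i<len′ : i < len W ∸ d
      i<len′ = m+n≤o⇒m≤o∸n (suc i) (subst (_≤ len W) (≡.sym 1+i+d≡j) j≤len)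
      lifted : ∀ {t} → t ≤ len W ∸ d → t + d ≤ len W
      lifted t≤ = ≤-trans (+-monoˡ-≤ d t≤) (≤-reflexive (m∸n+n≡m d≤len))
      inside′ : ∀ {t} → t ≤ len W ∸ d → I (vertex W (skip i d t))
      inside′ {t} t≤ with t ≤? i
      ... | yes _ = inside W (≤-trans t≤ (m∸n≤m (len W) d))
      ... | no  _ = inside W (lifted t≤)
      edge′ : ∀ {t} → t < len W ∸ d → Adj G (vertex W (skip i d t)) (vertex W (skip i d (suc t)))
      edge′ {t} t< with <-cmp t i
      ... | tri< t<i _ _ = subst₂ (Adj G) (cong (vertex W) (≡.sym (skip-≤ (<⇒≤ t<i))))
                                  (cong (vertex W) (≡.sym (skip-≤ t<i)))
                                  (edge W (≤-trans t< (m∸n≤m (len W) d)))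
      ... | tri≈ _ refl _ = subst₂ (Adj G) (cong (vertex W) (≡.sym (skip-≤ ≤-refl)))
                                  (cong (vertex W) (≡.sym (≡.trans (skip-> {i} {d} ≤-refl) 1+i+d≡j))) i~j
      ... | tri> _ _ i<t = subst₂ (Adj G) (cong (vertex W) (≡.sym (skip-> i<t)))
                                  (cong (vertex W) (≡.sym (skip-> (m<n⇒m<1+n i<t))))
                                  (edge W (lifted t<))

    chordTo? : (W : Walk I S T) → Decidable (λ j → ∃ λ i → i < j × (suc i < j × Adj G (vertex W i) (vertex W j)))
    chordTo? W j = anyUpTo? (λ i → (suc i <? j) ×-dec dec G (vertex W i) (vertex W j)) j

    module _ (S? : Decidable S) (T? : Decidable T) where

      shorten : (W : Walk I S T) → Tight W ⊎ (∃[ W′ ] len W′ < len W)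
      shorten W with anyUpTo? (T? ∘ vertex W) (len W)
      ... | yes (k , k<len , Tk) = inj₂ (truncate W (<⇒≤ k<len) Tk , k<len)
      ... | no ¬earlyT with anyUpTo? (S? ∘ vertex W ∘ suc) (len W)
      ...   | yes (k , k<len , Sk) =
                inj₂ (dropPrefix W k<len Sk , ∸-monoʳ-< {len W} z<s k<len)
      ...   | no ¬lateS with anyUpTo? (chordTo? W) (suc (len W))
      ...     | yes (j , s≤s j≤len , i , _ , 1+i<j , i~j) =
                  inj₂ (shortcut W 1+i<j j≤len i~j
                       , ∸-monoʳ-< {len W} (m<n⇒0<n∸m 1+i<j) (≤-trans (m∸n≤m j (suc i)) j≤len))
      ...     | no ¬chord = inj₁ (record
                  { T-only-at-end   = λ i<len Ti → ¬earlyT (_ , i<len , Ti)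
                  ; S-only-at-start = λ { {suc i} _ i<len Si → ¬lateS (i , i<len , Si) }
                  ; chordless       = λ 1+i<j j≤len i~j →
                                        ¬chord (_ , s≤s j≤len , _ , <-trans (n<1+n _) 1+i<j , 1+i<j , i~j)
                  })

      tighten : Walk I S T → Σ (Walk I S T) Tight
      tighten W = go W (<-wellFounded (len W))
        where
        go : (W : Walk I S T) → Acc _<_ (len W) → Σ (Walk I S T) Tight
        go W (acc shorter) with shorten W
        ... | inj₁ tight      = W , tight
        ... | inj₂ (W′ , lt) = go W′ (shorter lt)

  fromWalkIn : ∀ {X T a b} → WalkIn G X a b → T b → Walk (_∈ X) (_≡ a) T
  fromWalkIn (here a∈X) Ta = record
    { len = 0 ; vertex = λ _ → _ ; inside = λ _ → a∈X ; edge = λ () ; start = refl ; end = Ta }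
  fromWalkIn {X} {T} (step {w = c} a∈X a~c rest) Tb = prepend a∈X W (subst (Adj G _) (≡.sym (start W)) a~c)
    where
    W : Walk (_∈ X) (_≡ c) T
    W = fromWalkIn rest Tb

  module _ (meyniel : Meyniel G) {a b c : Fin n} (a~b : Adj G a b) (a~c : Adj G a c) (b~c : Adj G b c)
           {I : Pred (Fin n) 0ℓ} (a≁I : ∀ {v} → I v → ¬ Adj G a v)
           (W : Walk I (λ v → Adj G v b) (λ v → Adj G v c)) (tight : Tight W) where

    open Tight tight

    private
      m : ℕ
      m = len W
      u : ℕ → Fin n
      u = vertex W

    b-only-at-start : ∀ {i} → i ≤ m → Adj G (u i) b → i ≡ 0
    b-only-at-start {zero}  _   _   = refl
    b-only-at-start {suc i} i≤m u~b = contradiction u~b (S-only-at-start z<s i≤m)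

    c-only-at-end : ∀ {i} → i ≤ m → Adj G (u i) c → i ≡ m
    c-only-at-end i≤m u~c with m≤n⇒m<n∨m≡n i≤m
    ... | inj₁ i<m = contradiction u~c (T-only-at-end i<m)
    ... | inj₂ i≡m = i≡m

    a-misses : ∀ {i} → i ≤ m → ¬ Adj G a (u i)
    a-misses i≤m = a≁I (inside W i≤m)

    path-adj : ∀ {i j} → i < j → j ≤ m → Adj G (u i) (u j) → suc i ≡ j
    path-adj i<j j≤m u~u with m≤n⇒m<n∨m≡n i<j
    ... | inj₁ 1+i<j = contradiction u~u (chordless 1+i<j j≤m)
    ... | inj₂ 1+i≡j = 1+i≡j

    earlier≢later : ∀ {i j} → i < j → j ≤ m → u i ≢ u j
    earlier≢later {i} {j} i<j j≤m eq with m≤n⇒m<n∨m≡n j≤m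
    ... | inj₁ j<m  = chordless (s≤s i<j) j<m (subst (λ v → Adj G v (u (suc j))) (≡.sym eq) (edge W j<m))
    ... | inj₂ refl = <⇒≢ i<j (c-only-at-end (<⇒≤ i<j) (subst (λ v → Adj G v c) (≡.sym eq) (end W)))

    u-injective : ∀ {i j} → i ≤ m → j ≤ m → u i ≡ u j → i ≡ j
    u-injective {i} {j} i≤m j≤m eq with <-cmp i j
    ... | tri< i<j _ _ = contradiction eq (earlier≢later i<j j≤m)
    ... | tri≈ _ i≡j _ = i≡j
    ... | tri> _ _ j<i = contradiction (≡.sym eq) (earlier≢later j<i i≤m)

    u≢b : ∀ {i} → i ≤ m → u i ≢ b
    u≢b i≤m eq = a-misses i≤m (subst (Adj G a) (≡.sym eq) a~b)

    u≢c : ∀ {i} → i ≤ m → u i ≢ c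
    u≢c i≤m eq = a-misses i≤m (subst (Adj G a) (≡.sym eq) a~c)

    u≢a : 0 < m → ∀ {i} → i ≤ m → u i ≢ a
    u≢a 0<m i≤m eq = <⇒≢ 0<m (≡.trans (≡.sym (b-only-at-start i≤m u~b)) (c-only-at-end i≤m u~c))
      where
      u~b = subst (λ v → Adj G v b) (≡.sym eq) a~b
      u~c = subst (λ v → Adj G v c) (≡.sym eq) a~c

    hole : CyclicSequence (suc (suc m))
    hole = record
      { vertex    = c ◁ b ◁ u
      ; 2≤ℓ       = s≤s (s≤s z≤n)
      ; injective = ◁-injective (◁-avoids (adj⇒≢ b~c) u≢c) (◁-injective u≢b u-injective)
      ; edge      = ◁-edge (sym G b~c) (◁-edge (sym G (start W)) (edge W))
      ; close     = end W
      }

    hole-chordless : CyclicSequence.ChordsWithin hole (λ _ _ → ⊥)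
    hole-chordless {zero}        {suc zero}    _                 _                 _   = inj₁ refl
    hole-chordless {zero}        {suc (suc t)} _                 (s≤s (s≤s t≤m)) c~u =
      inj₂ (inj₁ (refl , cong (suc ∘ suc) (c-only-at-end t≤m (sym G c~u))))
    hole-chordless {suc zero}    {suc (suc t)} _                 (s≤s (s≤s t≤m)) b~u =
      inj₁ (cong (suc ∘ suc) (≡.sym (b-only-at-start t≤m (sym G b~u))))
    hole-chordless {suc zero}    {suc zero}    (s≤s ())         _                 _
    hole-chordless {suc (suc s)} {suc (suc t)} (s≤s (s≤s s<t)) (s≤s (s≤s t≤m)) u~u =
      inj₁ (cong (suc ∘ suc) (path-adj s<t t≤m u~u))

    holeThroughApex : 0 < m → CyclicSequence (suc (suc (suc m)))
    holeThroughApex 0<m = record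
      { vertex    = c ◁ a ◁ b ◁ u
      ; 2≤ℓ       = s≤s (s≤s z≤n)
      ; injective = ◁-injective (◁-avoids (adj⇒≢ a~c) (◁-avoids (adj⇒≢ b~c) u≢c))
                      (◁-injective (◁-avoids (adj⇒≢ (sym G a~b)) (u≢a 0<m)) (◁-injective u≢b u-injective))
      ; edge      = ◁-edge (sym G a~c) (◁-edge a~b (◁-edge (sym G (start W)) (edge W)))
      ; close     = end W
      }

    holeThroughApex-chords : (0<m : 0 < m) →
      CyclicSequence.ChordsWithin (holeThroughApex 0<m) (λ i j → i ≡ 0 × j ≡ 2)
    holeThroughApex-chords _ {zero}              {suc zero}          _ _ _ = inj₁ refl
    holeThroughApex-chords _ {zero}              {suc (suc zero)}    _ _ _ = inj₂ (inj₂ (refl , refl))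
    holeThroughApex-chords _ {zero}              {suc (suc (suc t))} _ (s≤s (s≤s (s≤s t≤m))) c~u =
      inj₂ (inj₁ (refl , cong (suc ∘ suc ∘ suc) (c-only-at-end t≤m (sym G c~u))))
    holeThroughApex-chords _ {suc zero}          {suc (suc zero)}    _ _ _ = inj₁ refl
    holeThroughApex-chords _ {suc zero}          {suc (suc (suc t))} _ (s≤s (s≤s (s≤s t≤m))) a~u =
      contradiction a~u (a-misses t≤m)
    holeThroughApex-chords _ {suc (suc zero)}    {suc (suc (suc t))} _ (s≤s (s≤s (s≤s t≤m))) b~u =
      inj₁ (cong (suc ∘ suc ∘ suc) (≡.sym (b-only-at-start t≤m (sym G b~u))))
    holeThroughApex-chords _ {suc zero}          {suc zero}          (s≤s ()) _ _
    holeThroughApex-chords _ {suc (suc zero)}    {suc zero}          (s≤s ()) _ _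
    holeThroughApex-chords _ {suc (suc zero)}    {suc (suc zero)}    (s≤s (s≤s ())) _ _
    holeThroughApex-chords _ {suc (suc (suc s))} {suc (suc (suc t))} (s≤s (s≤s (s≤s s<t))) (s≤s (s≤s (s≤s t≤m))) u~u =
      inj₁ (cong (suc ∘ suc ∘ suc) (path-adj s<t t≤m u~u))

    triangleOverTightPath-⊥ : 0 < m → ⊥
    triangleOverTightPath-⊥ 0<m with odd⊎odd-suc (suc (suc (suc m)))
    ... | inj₁ odd = Meyniel⇒¬oddCycleWithAtMostOneChord meyniel hole (s≤s (s≤s (odd-3+k⇒2≤k 0<m odd)))
                       odd (λ ()) hole-chordless
    ... | inj₂ odd = Meyniel⇒¬oddCycleWithAtMostOneChord meyniel (holeThroughApex 0<m) (s≤s (s≤s (s≤s 0<m)))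
                       odd (λ { (refl , refl) (refl , refl) → refl , refl }) (holeThroughApex-chords 0<m)

  neighbourIn? : (X : Subset n) (v : Fin n) → Dec (∃[ x ] (x ∈ X × Adj G v x))
  neighbourIn? X v = any? (λ x → (x ∈? X) ×-dec dec G v x)

  undominated⊎dominated : (Q X : Subset n) →
    (∃[ q ] (q ∈ Q × (∀ x → x ∈ X → ¬ Adj G q x))) ⊎ (∀ q → q ∈ Q → ∃[ x ] (x ∈ X × Adj G q x))
  undominated⊎dominated Q X with any? (λ q → (q ∈? Q) ×-dec ¬? (neighbourIn? X q))
  ... | yes (q , q∈Q , ¬hit) = inj₁ (q , q∈Q , λ x x∈X q~x → ¬hit (x , x∈X , q~x))
  ... | no ¬undominated      = inj₂ λ q q∈Q →
    decidable-stable (neighbourIn? X q) (λ ¬hit → ¬undominated (q , q∈Q , ¬hit))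

module _ {n : ℕ} (G : Graph n) (meyniel : Meyniel G) (Q X : Subset n) (z : Fin n) (Q-clique : IsClique G Q)
         (X-connected : Connected G X) (z~Q : ∀ q → q ∈ Q → Adj G z q) (z≁X : ∀ x → x ∈ X → ¬ Adj G z x)
         where

  Q-neighbour? : ∀ v → Decidable (λ q → q ∈ Q × Adj G v q)
  Q-neighbour? v q = (q ∈? Q) ×-dec dec G v q

  N[_] : Fin n → Subset n
  N[ v ] = toSubset (Q-neighbour? v)

  ∈-N⁺ : ∀ {v q} → q ∈ Q → Adj G v q → q ∈ N[ v ]
  ∈-N⁺ {v} q∈Q v~q = ∈-toSubset⁺ (Q-neighbour? v) (q∈Q , v~q)

  ∈-N⁻ : ∀ {v q} → q ∈ N[ v ] → q ∈ Q × Adj G v q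
  ∈-N⁻ {v} = ∈-toSubset⁻ (Q-neighbour? v)

  tight-end-keeps-Q-neighbours : ∀ {x q q′} (W : Walk G (_∈ X) (_≡ x) (λ v → Adj G v q)) → Tight G W →
                                 q ∈ Q → q′ ∈ Q → Adj G x q′ → Adj G (Walk.last W) q′
  tight-end-keeps-Q-neighbours {x} {q} {q′} W tight q∈Q q′∈Q x~q′ =
    decidable-stable (dec G (last W) q′) λ e≁q′ →
      let W′ , tight′ = tighten G (λ v → dec G v q′) (λ v → dec G v q) (fromN[q′] e≁q′)
      in  triangleOverTightPath-⊥ G meyniel (z~Q q′ q′∈Q) (z~Q q q∈Q) (Q-clique q′ q q′∈Q q∈Q (q′≢q e≁q′))
            (z≁X _ ∘ proj₁) W′ tight′ (nontrivial W′)
    where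
    open Walk
    open Tight tight

    NotCommon : Pred (Fin n) 0ℓ
    NotCommon v = v ∈ X × ¬ (Adj G v q × Adj G v q′)

    q′≢q : ¬ Adj G (last W) q′ → q′ ≢ q
    q′≢q e≁q′ q′≡q = e≁q′ (subst (Adj G (last W)) (≡.sym q′≡q) (end W))

    fromN[q′] : ¬ Adj G (last W) q′ → Walk G NotCommon (λ v → Adj G v q′) (λ v → Adj G v q)
    fromN[q′] e≁q′ = record
      { len    = len W
      ; vertex = vertex W
      ; inside = λ i≤len → inside W i≤len , misses i≤len
      ; edge   = edge W
      ; start  = subst (λ v → Adj G v q′) (≡.sym (start W)) x~q′
      ; end    = end W
      }
      where
      misses : ∀ {i} → i ≤ len W → ¬ (Adj G (vertex W i) q × Adj G (vertex W i) q′)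
      misses i≤len with m≤n⇒m<n∨m≡n i≤len
      ... | inj₁ i<len = T-only-at-end i<len ∘ proj₁
      ... | inj₂ refl  = e≁q′ ∘ proj₂

    nontrivial : (W′ : Walk G NotCommon (λ v → Adj G v q′) (λ v → Adj G v q)) → 0 < len W′
    nontrivial W′ = n≢0⇒n>0 λ len≡0 →
      proj₂ (inside W′ z≤n) (subst (λ i → Adj G (vertex W′ i) q) len≡0 (end W′) , start W′)

  neighbourhood-grows : ∀ {x q y} → x ∈ X → q ∈ Q → ¬ Adj G x q → y ∈ X → Adj G y q →
                        ∃[ e ] e ∈ X × N[ x ] ⊂ N[ e ]
  neighbourhood-grows {x} {q} {y} x∈X q∈Q x≁q y∈X y~q
    with tighten G (_≟ x) (λ v → dec G v q) (fromWalkIn G (X-connected x y x∈X y∈X) y~q)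
  ... | W , tight =
    Walk.last W , Walk.inside W ≤-refl , N[x]⊆N[e] , q , ∈-N⁺ q∈Q (Walk.end W) , x≁q ∘ proj₂ ∘ ∈-N⁻
    where
    N[x]⊆N[e] : N[ x ] ⊆ N[ Walk.last W ]
    N[x]⊆N[e] q′∈ with ∈-N⁻ q′∈
    ... | q′∈Q , x~q′ = ∈-N⁺ q′∈Q (tight-end-keeps-Q-neighbours W tight q∈Q q′∈Q x~q′)

  dominated-⊥ : Nonempty G X → (∀ x → x ∈ X → ∃[ q ] (q ∈ Q × ¬ Adj G x q)) →
                (∀ q → q ∈ Q → ∃[ x ] (x ∈ X × Adj G q x)) → ⊥
  dominated-⊥ (x₀ , x₀∈X) non-neighbour dominated = go x₀∈X (⊃-wellFounded N[ x₀ ])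
    where
    go : ∀ {x} → x ∈ X → Acc _⊃_ N[ x ] → ⊥
    go {x} x∈X (acc larger) with non-neighbour x x∈X
    ... | q , q∈Q , x≁q with dominated q q∈Q
    ... | y , y∈X , q~y with neighbourhood-grows x∈X q∈Q x≁q y∈X (sym G q~y)
    ... | e , e∈X , N[x]⊂N[e] = go e∈X (larger N[x]⊂N[e])

lemma6 : ∀ {n : ℕ} (G : Graph n) → Meyniel G →
           (Q X : Subset n) (z : Fin n) →
           IsClique G Q →
           Nonempty G X →
           (∀ x → x ∈ X → x ∉ Q) →
           Connected G X →
           z ∉ Q → z ∉ X →
           (∀ q → q ∈ Q → Adj G z q) →
           (∀ x → x ∈ X → ¬ Adj G z x) →
           (∀ x → x ∈ X → ∃[ q ] (q ∈ Q × ¬ Adj G x q)) →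
           ∃[ q ] (q ∈ Q × (∀ x → x ∈ X → ¬ Adj G q x))
lemma6 G meyniel Q X z Q-clique nonempty _ X-connected _ _ z~Q z≁X non-neighbour
  with undominated⊎dominated G Q X
... | inj₁ undominated = undominated
... | inj₂ dominated   =
  ⊥-elim (dominated-⊥ G meyniel Q X z Q-clique X-connected z~Q z≁X nonempty non-neighbour dominated)
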